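{- None of the pure type systems $\lambda^\tau$, $\lambda2$, $\lambda\omega$, $\lambda\underline{\omega}$, $\lambda\mathrm{P2}$, $\lambda\mathrm{P}\underline{\omega}$, $\lambda\mathrm C$, $\lambda\mathrm{AUT\text{ - }68}$, $\lambda\mathrm{AUT\text{ - }QE}$, $\lambda\mathrm{PAL}$, $\lambda\mathrm U$ and $\lambda\mathrm{HOL}$ has an equivalent Hilbert-style pure type system.
   Context: Pure type systems (PTS): a PTS has variables, constants $\mathcal C$, sorts $\mathcal S\subseteq\mathcal C$, axioms $\mathcal A$ ($c:s$), rules $\mathcal R\subseteq\mathcal S^3$; pseudoterms $\mathcal T::=V\mid\mathcal C\mid\Pi V{:}\mathcal T.\mathcal T\mid\lambda V{:}\mathcal T.\mathcal T\mid\mathcal T\mathcal T$; derivable judgements $\Gamma\vdash M:A$ are generated by (axiom) $\vdash c:s$ for $(c:s)\in\mathcal A$; (start) $\Gamma\vdash A:s\Rightarrow\Gamma,x:A\vdash x:A$ ($x$ fresh); (weakening) $\Gamma\vdash M:B$, $\Gamma\vdash A:s\Rightarrow\Gamma,x:A\vdash M:B$ ($x$ fresh); (application) $\Gamma\vdash M:\Pi x{:}A.B$, $\Gamma\vdash N:A\Rightarrow\Gamma\vdash MN:B[x:=N]$; (abstraction) $\Gamma,x:A\vdash M:B$, $\Gamma\vdash(\Pi x{:}A.B):s\Rightarrow\Gamma\vdash(\lambda x{:}A.M):(\Pi x{:}A.B)$; (product) $\Gamma,x:A\vdash B:s_2$, $\Gamma\vdash A:s_1$, $(s_1,s_2,s_3)\in\mathcal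 R\Rightarrow\Gamma\vdash(\Pi x{:}A.B):s_3$; (conversion) $\Gamma\vdash M:A$, $\Gamma\vdash B:s$, $A=_\beta B\Rightarrow\Gamma\vdash M:B$. Hilbert-style PTS (HPTS): same pseudoterms, only empty contexts, axioms $\mathcal A$ plus a finite set $\mathcal B$ of axiom schemes (sort variables instantiable by sorts); rules: the axioms, (application), (conversion) with empty contexts, (type reduction) $\vdash M:A$, $A\to_\beta B\Rightarrow\vdash M:B$, (subject reduction) $\vdash M:A$, $M\to_\beta N\Rightarrow\vdash N:A$. An HPTS $(\mathcal S,\mathcal A,\mathcal B)$ is equivalent to the PTS $(\mathcal S,\mathcal A,\mathcal R)$ if both derive exactly the same empty-context judgements $\vdash M:A$. The systems (writing $(s_1,s_2)$ for $(s_1,s_2,s_2)$; except for $\lambda^\tau$, $\mathcal C=\mathcal S$ is the set of constants occurring in $\mathcal A$ and $\mathcal R$): $\lambda^\tau$: $\mathcal S=\{*\}$, $\mathcal C=\{*,0\}$, $\mathcal A=\{0:*\}$, $\mathcal R=\{(*,*)\}$. All the following have $\mathcal A=\{*:\square\}$ unless stated: $\lambda2$: $\mathcal R=\{(*,*),(\square,*)\}$; $\lambda\underline\omega$: $\{(*,*),(\square,\square)\}$; $\lambda\omega$: $\{(*,*),(\square,*),(\square,\square)\}$; $\lambda\mathrm{P2}$: $\{(*,*),(\square,*),(*,\square)\}$; $\lambda\mathrm P\underline\omega$: $\{(*,*),(*,\square),(\square,\square)\}$; $\lambda\mathrm C$: $\{(*,*),(*,\square),(\square,*),(\square,\square)\}$;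 $\lambda\mathrm{AUT\text{ - }68}$: $\{(*,*),(*,\square,\triangle),(\square,*,\triangle),(\square,\square,\triangle),(*,\triangle),(\square,\triangle)\}$; $\lambda\mathrm{AUT\text{ - }QE}$: $\{(*,*),(*,\square),(\square,*,\triangle),(\square,\square,\triangle),(*,\triangle),(\square,\triangle)\}$; $\lambda\mathrm{PAL}$: $\{(*,*,\triangle),(*,\square,\triangle),(\square,*,\triangle),(\square,\square,\triangle),(*,\triangle),(\square,\triangle)\}$; $\lambda\mathrm U$: $\mathcal A=\{*:\square,\square:\triangle\}$, $\mathcal R=\{(*,*),(\square,*),(\square,\square),(\triangle,\square),(\triangle,*)\}$; $\lambda\mathrm{HOL}$: $\mathcal A=\{*:\square,\square:\triangle\}$, $\mathcal R=\{(*,*),(\square,*),(\square,\square)\}$. -}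

module Defs where

open import Data.Nat using (ℕ; zero; suc)
open import Data.List using (List; []; _∷_)
open import Data.List.Membership.Propositional using (_∈_)
open import Data.Product using (Σ; _×_; _,_; proj₁)
open import Data.Sum using (_⊎_; inj₁; inj₂)
open import Relation.Binary.Construct.Closure.Equivalence using (EqClosure)
open import Relation.Nullary using (¬_)

-- Pseudoterms over a set of constants C, with de Bruijn indices for
-- variables (terms are thus identified up to alpha-conversion).
-- Π A B and ƛ A M bind variable 0 in B resp. M.

data Term (C : Set) : Set where
  var : ℕ → Term C
  con : C → Term C
  Π   : Term C → Term C → Term C
  ƛ   : Term C → Term C → Term C
  _·_ : Term C → Term C → Term C

infixl 7 _·_

module _ {C : Set} where

  ext : (ℕ → ℕ) → ℕ → ℕ
  ext ρ zero    = zero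
  ext ρ (suc n) = suc (ρ n)

  rename : (ℕ → ℕ) → Term C → Term C
  rename ρ (var n) = var (ρ n)
  rename ρ (con c) = con c
  rename ρ (Π A B) = Π (rename ρ A) (rename (ext ρ) B)
  rename ρ (ƛ A M) = ƛ (rename ρ A) (rename (ext ρ) M)
  rename ρ (M · N) = rename ρ M · rename ρ N

  weaken : Term C → Term C
  weaken = rename suc

  exts : (ℕ → Term C) → ℕ → Term C
  exts σ zero    = var zero
  exts σ (suc n) = weaken (σ n)

  subst : (ℕ → Term C) → Term C → Term C
  subst σ (var n) = σ n
  subst σ (con c) = con c
  subst σ (Π A B) = Π (subst σ A) (subst (exts σ) B)
  subst σ (ƛ A M) = ƛ (subst σ A) (subst (exts σ) M)
  subst σ (M · N) = subst σ M · subst σ N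

  _[_] : Term C → Term C → Term C
  B [ N ] = subst σ B
    where
    σ : ℕ → Term C
    σ zero    = N
    σ (suc n) = var n

  data _⟶β_ : Term C → Term C → Set where
    β    : ∀ {A M N} → (ƛ A M · N) ⟶β (M [ N ])
    Πˡ   : ∀ {A A' B} → A ⟶β A' → Π A B ⟶β Π A' B
    Πʳ   : ∀ {A B B'} → B ⟶β B' → Π A B ⟶β Π A B'
    ƛˡ   : ∀ {A A' M} → A ⟶β A' → ƛ A M ⟶β ƛ A' M
    ƛʳ   : ∀ {A M M'} → M ⟶β M' → ƛ A M ⟶β ƛ A M'
    ·ˡ   : ∀ {M M' N} → M ⟶β M' → (M · N) ⟶β (M' · N)
    ·ʳ   : ∀ {M N N'} → N ⟶β N' → (M · N) ⟶β (M · N')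

  _=β_ : Term C → Term C → Set
  _=β_ = EqClosure _⟶β_

  mapCon : {D : Set} → (D → C) → Term D → Term C
  mapCon f (var n) = var n
  mapCon f (con c) = con (f c)
  mapCon f (Π A B) = Π (mapCon f A) (mapCon f B)
  mapCon f (ƛ A M) = ƛ (mapCon f A) (mapCon f M)
  mapCon f (M · N) = mapCon f M · mapCon f N

record PTS : Set₁ where
  field
    Const  : Set
    sorts  : List Const
    axioms : List (Const × Const)                -- (c , s) means c : s
    rules  : List (Const × Const × Const)

module Typing (P : PTS) where
  open PTS P

  Sort : Const → Set
  Sort s = s ∈ sorts

  Ctx : Set
  Ctx = List (Term Const)     -- most recent declaration first

  data _⊢_∶_ : Ctx → Term Const → Term Const → Set where
    axiom : ∀ {c s} → (c , s) ∈ axioms → [] ⊢ con c ∶ con s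
    start : ∀ {Γ A s} → Sort s → Γ ⊢ A ∶ con s →
            (A ∷ Γ) ⊢ var zero ∶ weaken A
    weakening : ∀ {Γ M B A s} → Sort s → Γ ⊢ M ∶ B → Γ ⊢ A ∶ con s →
            (A ∷ Γ) ⊢ weaken M ∶ weaken B
    application : ∀ {Γ M N A B} → Γ ⊢ M ∶ Π A B → Γ ⊢ N ∶ A →
            Γ ⊢ M · N ∶ (B [ N ])
    abstraction : ∀ {Γ A M B s} → Sort s → (A ∷ Γ) ⊢ M ∶ B →
            Γ ⊢ Π A B ∶ con s → Γ ⊢ ƛ A M ∶ Π A B
    product : ∀ {Γ A B s₁ s₂ s₃} → (A ∷ Γ) ⊢ B ∶ con s₂ → Γ ⊢ A ∶ con s₁ →
            (s₁ , s₂ , s₃) ∈ rules → Γ ⊢ Π A B ∶ con s₃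
    conversion : ∀ {Γ M A B s} → Sort s → Γ ⊢ M ∶ A → Γ ⊢ B ∶ con s →
            A =β B → Γ ⊢ M ∶ B

  -- pseudoterms with sort variables (inj₂ n is sort variable n)
  SchemeTerm : Set
  SchemeTerm = Term (Const ⊎ ℕ)

  Scheme : Set
  Scheme = SchemeTerm × SchemeTerm

  SortInst : Set
  SortInst = ℕ → Σ Const Sort

  inst : SortInst → SchemeTerm → Term Const
  inst σ = mapCon f
    where
    f : Const ⊎ ℕ → Const
    f (inj₁ c) = c
    f (inj₂ n) = proj₁ (σ n)

  data ⊢H[_]_∶_ (𝓑 : List Scheme) : Term Const → Term Const → Set where
    axiom : ∀ {c s} → (c , s) ∈ axioms → ⊢H[ 𝓑 ] con c ∶ con s
    scheme : ∀ {M A} → (M , A) ∈ 𝓑 → (σ : SortInst) →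
             ⊢H[ 𝓑 ] inst σ M ∶ inst σ A
    application : ∀ {M N A B} → ⊢H[ 𝓑 ] M ∶ Π A B → ⊢H[ 𝓑 ] N ∶ A →
             ⊢H[ 𝓑 ] M · N ∶ (B [ N ])
    conversion : ∀ {M A B s} → Sort s → ⊢H[ 𝓑 ] M ∶ A →
             ⊢H[ 𝓑 ] B ∶ con s → A =β B → ⊢H[ 𝓑 ] M ∶ B
    type-reduction : ∀ {M A B} → ⊢H[ 𝓑 ] M ∶ A → A ⟶β B → ⊢H[ 𝓑 ] M ∶ B
    subject-reduction : ∀ {M N A} → ⊢H[ 𝓑 ] M ∶ A → M ⟶β N →
             ⊢H[ 𝓑 ] N ∶ A

  Equivalent : List Scheme → Set
  Equivalent 𝓑 = ∀ M A → ([] ⊢ M ∶ A → ⊢H[ 𝓑 ] M ∶ A)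
                       × (⊢H[ 𝓑 ] M ∶ A → [] ⊢ M ∶ A)

  HasEquivalentHPTS : Set
  HasEquivalentHPTS = Σ (List Scheme) Equivalent

data Kτ : Set where
  ⋆ 𝟎 : Kτ

data K₂ : Set where
  ⋆ □ : K₂

data K₃ : Set where
  ⋆ □ △ : K₃

λτ : PTS
λτ = record { Const = Kτ ; sorts = ⋆ ∷ [] ; axioms = (𝟎 , ⋆) ∷ []
            ; rules = (⋆ , ⋆ , ⋆) ∷ [] }

mk₂ : List (K₂ × K₂ × K₂) → PTS
mk₂ R = record { Const = K₂ ; sorts = ⋆ ∷ □ ∷ [] ; axioms = (⋆ , □) ∷ []
               ; rules = R }

mk₃ : List (K₃ × K₃) → List (K₃ × K₃ × K₃) → PTS
mk₃ A R = record { Const = K₃ ; sorts = ⋆ ∷ □ ∷ △ ∷ [] ; axioms = A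
                 ; rules = R }

λ2 λω̲ λω λP2 λPω̲ λC : PTS
λ2   = mk₂ ((⋆ , ⋆ , ⋆) ∷ (□ , ⋆ , ⋆) ∷ [])
λω̲   = mk₂ ((⋆ , ⋆ , ⋆) ∷ (□ , □ , □) ∷ [])
λω   = mk₂ ((⋆ , ⋆ , ⋆) ∷ (□ , ⋆ , ⋆) ∷ (□ , □ , □) ∷ [])
λP2  = mk₂ ((⋆ , ⋆ , ⋆) ∷ (□ , ⋆ , ⋆) ∷ (⋆ , □ , □) ∷ [])
λPω̲  = mk₂ ((⋆ , ⋆ , ⋆) ∷ (⋆ , □ , □) ∷ (□ , □ , □) ∷ [])
λC   = mk₂ ((⋆ , ⋆ , ⋆) ∷ (⋆ , □ , □) ∷ (□ , ⋆ , ⋆) ∷ (□ , □ , □) ∷ [])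

λAUT-68 λAUT-QE λPAL λU λHOL : PTS
λAUT-68 = mk₃ ((⋆ , □) ∷ [])
  ((⋆ , ⋆ , ⋆) ∷ (⋆ , □ , △) ∷ (□ , ⋆ , △) ∷ (□ , □ , △) ∷ (⋆ , △ , △)
   ∷ (□ , △ , △) ∷ [])
λAUT-QE = mk₃ ((⋆ , □) ∷ [])
  ((⋆ , ⋆ , ⋆) ∷ (⋆ , □ , □) ∷ (□ , ⋆ , △) ∷ (□ , □ , △) ∷ (⋆ , △ , △)
   ∷ (□ , △ , △) ∷ [])
λPAL = mk₃ ((⋆ , □) ∷ [])
  ((⋆ , ⋆ , △) ∷ (⋆ , □ , △) ∷ (□ , ⋆ , △) ∷ (□ , □ , △) ∷ (⋆ , △ , △)
   ∷ (□ , △ , △) ∷ [])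
λU = mk₃ ((⋆ , □) ∷ (□ , △) ∷ [])
  ((⋆ , ⋆ , ⋆) ∷ (□ , ⋆ , ⋆) ∷ (□ , □ , □) ∷ (△ , □ , □) ∷ (△ , ⋆ , ⋆) ∷ [])
λHOL = mk₃ ((⋆ , □) ∷ (□ , △) ∷ [])
  ((⋆ , ⋆ , ⋆) ∷ (□ , ⋆ , ⋆) ∷ (□ , □ , □) ∷ [])

data System : Set where
  sλτ sλ2 sλω sλω̲ sλP2 sλPω̲ sλC sλAUT-68 sλAUT-QE sλPAL sλU sλHOL : System

pts : System → PTS
pts sλτ      = λτ
pts sλ2      = λ2
pts sλω      = λω
pts sλω̲      = λω̲
pts sλP2     = λP2
pts sλPω̲     = λPω̲
pts sλC      = λC
pts sλAUT-68 = λAUT-68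
pts sλAUT-QE = λAUT-QE
pts sλPAL    = λPAL
pts sλU      = λU
pts sλHOL    = λHOL

-- Each of these systems has a sort u that is never, up to β, the type of an
-- application: the constants hidden together with u occur inside a derivable
-- term only as the whole term or as a binder domain, whereas the type B[N] of
-- an application is built from such clean terms B and N, and a clean term does
-- not convert to a hidden sort. In a Hilbert-style system an inhabitant of u
-- is therefore a β-reduct of an axiom or of an instance of one of finitely
-- many schemes, and after erasing constants these are finitely many terms.
-- But the PTS types Πx₁:A. … Πxₙ:A. B : u for every n; these are β-normal with
-- pairwise distinct erasures, and by confluence finitely many terms have only
-- finitely many normal forms.

module Submission where

open import Data.Bool using (Bool; true; false; T)
open import Data.Empty using (⊥; ⊥-elim)
open import Data.Fin using (Fin; toℕ) renaming (zero to fzero; suc to fsuc)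
open import Data.Fin.Properties using (pigeonhole)
open import Data.List using (List; []; _∷_; length; lookup; replicate)
open import Data.List.Membership.Propositional using (_∈_)
open import Data.List.Relation.Unary.Any using (here; there; index)
open import Data.List.Relation.Unary.Any.Properties using (lookup-index)
open import Data.Nat using (ℕ; zero; suc; _+_)
open import Data.Nat.Properties using (n<1+n; <-irrefl; +-cancelʳ-≡)
open import Data.Product using (∃-syntax; _×_; _,_; proj₁; proj₂)
open import Data.Sum using (_⊎_; inj₁; inj₂; [_,_])
open import Data.Unit using (⊤; tt)
open import Function using (_∘_; id)
open import Relation.Binary.Construct.Closure.Equivalence as EqClosure using ()
open import Relation.Binary.Construct.Closure.Equivalence.Properties
  using (a—↠b&a—↠c⇒b↔c)
open import Relation.Binary.Construct.Closure.ReflexiveTransitive as Star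
  using (Star; ε; _◅_; _◅◅_)
open import Relation.Binary.Construct.Closure.ReflexiveTransitive.Properties
  using (reflexive)
open import Relation.Binary.Construct.Closure.Symmetric using (fwd)
open import Relation.Binary.PropositionalEquality
  using (_≡_; _≗_; refl; sym; trans; cong; cong₂; module ≡-Reasoning)
  renaming (subst to transport; subst₂ to transport₂)
open import Relation.Binary.Rewriting
  using (Confluent; IsNormalForm; conf⇒nf; conf⇒unf)
open import Relation.Nullary using (¬_; yes; no)
open import Relation.Nullary.Decidable using (T?)

open import Defs

module _ {C : Set} where

  ext-cong : ∀ {ρ ρ′ : ℕ → ℕ} → ρ ≗ ρ′ → ext {C} ρ ≗ ext {C} ρ′
  ext-cong h zero    = refl
  ext-cong h (suc n) = cong suc (h n)

  rename-cong : ∀ {ρ ρ′ : ℕ → ℕ} → ρ ≗ ρ′ → rename {C} ρ ≗ rename ρ′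
  rename-cong h (var n) = cong var (h n)
  rename-cong h (con c) = refl
  rename-cong h (Π A B) = cong₂ Π (rename-cong h A) (rename-cong (ext-cong h) B)
  rename-cong h (ƛ A M) = cong₂ ƛ (rename-cong h A) (rename-cong (ext-cong h) M)
  rename-cong h (M · N) = cong₂ _·_ (rename-cong h M) (rename-cong h N)

  exts-cong : ∀ {σ τ : ℕ → Term C} → σ ≗ τ → exts σ ≗ exts τ
  exts-cong h zero    = refl
  exts-cong h (suc n) = cong weaken (h n)

  subst-cong : ∀ {σ τ : ℕ → Term C} → σ ≗ τ → subst σ ≗ subst τ
  subst-cong h (var n) = h n
  subst-cong h (con c) = refl
  subst-cong h (Π A B) = cong₂ Π (subst-cong h A) (subst-cong (exts-cong h) B)
  subst-cong h (ƛ A M) = cong₂ ƛ (subst-cong h A) (subst-cong (exts-cong h) M)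
  subst-cong h (M · N) = cong₂ _·_ (subst-cong h M) (subst-cong h N)

  ext-∘ : ∀ (ρ ρ′ : ℕ → ℕ) → ext {C} ρ ∘ ext {C} ρ′ ≗ ext {C} (ρ ∘ ρ′)
  ext-∘ ρ ρ′ zero    = refl
  ext-∘ ρ ρ′ (suc n) = refl

  rename-∘ : ∀ (ρ ρ′ : ℕ → ℕ) (M : Term C) → rename ρ (rename ρ′ M) ≡ rename (ρ ∘ ρ′) M
  rename-∘ ρ ρ′ (var n) = refl
  rename-∘ ρ ρ′ (con c) = refl
  rename-∘ ρ ρ′ (Π A B) = cong₂ Π (rename-∘ ρ ρ′ A)
    (trans (rename-∘ (ext {C} ρ) (ext {C} ρ′) B) (rename-cong (ext-∘ ρ ρ′) B))
  rename-∘ ρ ρ′ (ƛ A M) = cong₂ ƛ (rename-∘ ρ ρ′ A)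
    (trans (rename-∘ (ext {C} ρ) (ext {C} ρ′) M) (rename-cong (ext-∘ ρ ρ′) M))
  rename-∘ ρ ρ′ (M · N) = cong₂ _·_ (rename-∘ ρ ρ′ M) (rename-∘ ρ ρ′ N)

  exts-ext : ∀ (σ : ℕ → Term C) (ρ : ℕ → ℕ) → exts σ ∘ ext {C} ρ ≗ exts (σ ∘ ρ)
  exts-ext σ ρ zero    = refl
  exts-ext σ ρ (suc n) = refl

  subst-rename : ∀ (σ : ℕ → Term C) (ρ : ℕ → ℕ) (M : Term C) →
                 subst σ (rename ρ M) ≡ subst (σ ∘ ρ) M
  subst-rename σ ρ (var n) = refl
  subst-rename σ ρ (con c) = refl
  subst-rename σ ρ (Π A B) = cong₂ Π (subst-rename σ ρ A)
    (trans (subst-rename (exts σ) (ext {C} ρ) B) (subst-cong (exts-ext σ ρ) B))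
  subst-rename σ ρ (ƛ A M) = cong₂ ƛ (subst-rename σ ρ A)
    (trans (subst-rename (exts σ) (ext {C} ρ) M) (subst-cong (exts-ext σ ρ) M))
  subst-rename σ ρ (M · N) = cong₂ _·_ (subst-rename σ ρ M) (subst-rename σ ρ N)

  ext-exts : ∀ (ρ : ℕ → ℕ) (σ : ℕ → Term C) → rename (ext {C} ρ) ∘ exts σ ≗ exts (rename ρ ∘ σ)
  ext-exts ρ σ zero    = refl
  ext-exts ρ σ (suc n) = trans (rename-∘ (ext {C} ρ) suc (σ n)) (sym (rename-∘ suc ρ (σ n)))

  rename-subst : ∀ (ρ : ℕ → ℕ) (σ : ℕ → Term C) (M : Term C) →
                 rename ρ (subst σ M) ≡ subst (rename ρ ∘ σ) M
  rename-subst ρ σ (var n) = refl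
  rename-subst ρ σ (con c) = refl
  rename-subst ρ σ (Π A B) = cong₂ Π (rename-subst ρ σ A)
    (trans (rename-subst (ext {C} ρ) (exts σ) B) (subst-cong (ext-exts ρ σ) B))
  rename-subst ρ σ (ƛ A M) = cong₂ ƛ (rename-subst ρ σ A)
    (trans (rename-subst (ext {C} ρ) (exts σ) M) (subst-cong (ext-exts ρ σ) M))
  rename-subst ρ σ (M · N) = cong₂ _·_ (rename-subst ρ σ M) (rename-subst ρ σ N)

  exts-∘ : ∀ (τ σ : ℕ → Term C) → subst (exts τ) ∘ exts σ ≗ exts (subst τ ∘ σ)
  exts-∘ τ σ zero    = refl
  exts-∘ τ σ (suc n) = trans (subst-rename (exts τ) suc (σ n)) (sym (rename-subst suc τ (σ n)))

  subst-∘ : ∀ (τ σ : ℕ → Term C) (M : Term C) → subst τ (subst σ M) ≡ subst (subst τ ∘ σ) M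
  subst-∘ τ σ (var n) = refl
  subst-∘ τ σ (con c) = refl
  subst-∘ τ σ (Π A B) = cong₂ Π (subst-∘ τ σ A)
    (trans (subst-∘ (exts τ) (exts σ) B) (subst-cong (exts-∘ τ σ) B))
  subst-∘ τ σ (ƛ A M) = cong₂ ƛ (subst-∘ τ σ A)
    (trans (subst-∘ (exts τ) (exts σ) M) (subst-cong (exts-∘ τ σ) M))
  subst-∘ τ σ (M · N) = cong₂ _·_ (subst-∘ τ σ M) (subst-∘ τ σ N)

  exts-var : exts var ≗ var {C}
  exts-var zero    = refl
  exts-var (suc n) = refl

  subst-var : ∀ (M : Term C) → subst var M ≡ M
  subst-var (var n) = refl
  subst-var (con c) = refl
  subst-var (Π A B) = cong₂ Π (subst-var A) (trans (subst-cong exts-var B) (subst-var B))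
  subst-var (ƛ A M) = cong₂ ƛ (subst-var A) (trans (subst-cong exts-var M) (subst-var M))
  subst-var (M · N) = cong₂ _·_ (subst-var M) (subst-var N)

  ext-as-exts : ∀ (ρ : ℕ → ℕ) → var {C} ∘ ext {C} ρ ≗ exts (var ∘ ρ)
  ext-as-exts ρ zero    = refl
  ext-as-exts ρ (suc n) = refl

  rename-as-subst : ∀ (ρ : ℕ → ℕ) (M : Term C) → rename ρ M ≡ subst (var ∘ ρ) M
  rename-as-subst ρ (var n) = refl
  rename-as-subst ρ (con c) = refl
  rename-as-subst ρ (Π A B) = cong₂ Π (rename-as-subst ρ A)
    (trans (rename-as-subst (ext {C} ρ) B) (subst-cong (ext-as-exts ρ) B))
  rename-as-subst ρ (ƛ A M) = cong₂ ƛ (rename-as-subst ρ A)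
    (trans (rename-as-subst (ext {C} ρ) M) (subst-cong (ext-as-exts ρ) M))
  rename-as-subst ρ (M · N) = cong₂ _·_ (rename-as-subst ρ M) (rename-as-subst ρ N)

  sub₀ : Term C → ℕ → Term C
  sub₀ N zero    = N
  sub₀ N (suc n) = var n

  []-as-subst : ∀ (M N : Term C) → M [ N ] ≡ subst (sub₀ N) M
  []-as-subst M N = subst-cong (λ { zero → refl ; (suc n) → refl }) M

  subst-[] : ∀ (τ : ℕ → Term C) (M N : Term C) →
             subst τ (M [ N ]) ≡ subst (exts τ) M [ subst τ N ]
  subst-[] τ M N = begin
      subst τ (M [ N ])                              ≡⟨ cong (subst τ) ([]-as-subst M N) ⟩
      subst τ (subst (sub₀ N) M)                     ≡⟨ subst-∘ τ (sub₀ N) M ⟩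
      subst (subst τ ∘ sub₀ N) M                     ≡⟨ subst-cong pointwise M ⟩
      subst (subst (sub₀ (subst τ N)) ∘ exts τ) M    ≡⟨ sym (subst-∘ (sub₀ (subst τ N)) (exts τ) M) ⟩
      subst (sub₀ (subst τ N)) (subst (exts τ) M)    ≡⟨ sym ([]-as-subst (subst (exts τ) M) (subst τ N)) ⟩
      subst (exts τ) M [ subst τ N ]                 ∎
    where
    open ≡-Reasoning
    pointwise : subst τ ∘ sub₀ N ≗ subst (sub₀ (subst τ N)) ∘ exts τ
    pointwise zero    = refl
    pointwise (suc n) = sym (trans (subst-rename (sub₀ (subst τ N)) suc (τ n)) (subst-var (τ n)))

  rename-[] : ∀ (ρ : ℕ → ℕ) (M N : Term C) →
              rename ρ (M [ N ]) ≡ rename (ext {C} ρ) M [ rename ρ N ]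
  rename-[] ρ M N = begin
      rename ρ (M [ N ])                           ≡⟨ rename-as-subst ρ (M [ N ]) ⟩
      subst (var ∘ ρ) (M [ N ])                    ≡⟨ subst-[] (var ∘ ρ) M N ⟩
      subst (exts (var ∘ ρ)) M [ subst (var ∘ ρ) N ]
        ≡⟨ sym (cong₂ _[_] (trans (rename-as-subst (ext {C} ρ) M) (subst-cong (ext-as-exts ρ) M))
                           (rename-as-subst ρ N)) ⟩
      rename (ext {C} ρ) M [ rename ρ N ]          ∎
    where open ≡-Reasoning

  rename-⟶β : ∀ (ρ : ℕ → ℕ) {M N : Term C} → M ⟶β N → rename ρ M ⟶β rename ρ N
  rename-⟶β ρ (β {A} {M} {N}) = transport (rename ρ (ƛ A M · N) ⟶β_) (sym (rename-[] ρ M N)) β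
  rename-⟶β ρ (Πˡ s) = Πˡ (rename-⟶β ρ s)
  rename-⟶β ρ (Πʳ s) = Πʳ (rename-⟶β (ext {C} ρ) s)
  rename-⟶β ρ (ƛˡ s) = ƛˡ (rename-⟶β ρ s)
  rename-⟶β ρ (ƛʳ s) = ƛʳ (rename-⟶β (ext {C} ρ) s)
  rename-⟶β ρ (·ˡ s) = ·ˡ (rename-⟶β ρ s)
  rename-⟶β ρ (·ʳ s) = ·ʳ (rename-⟶β ρ s)

  rename-=β : ∀ (ρ : ℕ → ℕ) {M N : Term C} → M =β N → rename ρ M =β rename ρ N
  rename-=β ρ = EqClosure.gmap (rename ρ) (rename-⟶β ρ)

module _ {C D : Set} (f : D → C) where

  mapCon-rename : ∀ (ρ : ℕ → ℕ) (M : Term D) → mapCon f (rename ρ M) ≡ rename ρ (mapCon f M)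
  mapCon-rename ρ (var n) = refl
  mapCon-rename ρ (con c) = refl
  mapCon-rename ρ (Π A B) = cong₂ Π (mapCon-rename ρ A) (mapCon-rename (ext {D} ρ) B)
  mapCon-rename ρ (ƛ A M) = cong₂ ƛ (mapCon-rename ρ A) (mapCon-rename (ext {D} ρ) M)
  mapCon-rename ρ (M · N) = cong₂ _·_ (mapCon-rename ρ M) (mapCon-rename ρ N)

  mapCon-exts : ∀ (σ : ℕ → Term D) → mapCon f ∘ exts σ ≗ exts (mapCon f ∘ σ)
  mapCon-exts σ zero    = refl
  mapCon-exts σ (suc n) = mapCon-rename suc (σ n)

  mapCon-subst : ∀ (σ : ℕ → Term D) (M : Term D) →
                 mapCon f (subst σ M) ≡ subst (mapCon f ∘ σ) (mapCon f M)
  mapCon-subst σ (var n) = refl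
  mapCon-subst σ (con c) = refl
  mapCon-subst σ (Π A B) = cong₂ Π (mapCon-subst σ A)
    (trans (mapCon-subst (exts σ) B) (subst-cong (mapCon-exts σ) (mapCon f B)))
  mapCon-subst σ (ƛ A M) = cong₂ ƛ (mapCon-subst σ A)
    (trans (mapCon-subst (exts σ) M) (subst-cong (mapCon-exts σ) (mapCon f M)))
  mapCon-subst σ (M · N) = cong₂ _·_ (mapCon-subst σ M) (mapCon-subst σ N)

  mapCon-[] : ∀ (M N : Term D) → mapCon f (M [ N ]) ≡ mapCon f M [ mapCon f N ]
  mapCon-[] M N = begin
      mapCon f (M [ N ])                          ≡⟨ cong (mapCon f) ([]-as-subst M N) ⟩
      mapCon f (subst (sub₀ N) M)                 ≡⟨ mapCon-subst (sub₀ N) M ⟩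
      subst (mapCon f ∘ sub₀ N) (mapCon f M)      ≡⟨ subst-cong (λ { zero → refl ; (suc n) → refl }) (mapCon f M) ⟩
      subst (sub₀ (mapCon f N)) (mapCon f M)      ≡⟨ sym ([]-as-subst (mapCon f M) (mapCon f N)) ⟩
      mapCon f M [ mapCon f N ]                   ∎
    where open ≡-Reasoning

  mapCon-⟶β : ∀ {M N : Term D} → M ⟶β N → mapCon f M ⟶β mapCon f N
  mapCon-⟶β (β {A} {M} {N}) = transport (mapCon f (ƛ A M · N) ⟶β_) (sym (mapCon-[] M N)) β
  mapCon-⟶β (Πˡ s) = Πˡ (mapCon-⟶β s)
  mapCon-⟶β (Πʳ s) = Πʳ (mapCon-⟶β s)
  mapCon-⟶β (ƛˡ s) = ƛˡ (mapCon-⟶β s)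
  mapCon-⟶β (ƛʳ s) = ƛʳ (mapCon-⟶β s)
  mapCon-⟶β (·ˡ s) = ·ˡ (mapCon-⟶β s)
  mapCon-⟶β (·ʳ s) = ·ʳ (mapCon-⟶β s)

erase : ∀ {C} → Term C → Term ⊤
erase = mapCon (λ _ → tt)

erase-mapCon : ∀ {C D} (f : D → C) (M : Term D) → erase (mapCon f M) ≡ erase M
erase-mapCon f (var n) = refl
erase-mapCon f (con c) = refl
erase-mapCon f (Π A B) = cong₂ Π (erase-mapCon f A) (erase-mapCon f B)
erase-mapCon f (ƛ A M) = cong₂ ƛ (erase-mapCon f A) (erase-mapCon f M)
erase-mapCon f (M · N) = cong₂ _·_ (erase-mapCon f M) (erase-mapCon f N)

module _ {C : Set} where

  _⟶*_ : Term C → Term C → Set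
  _⟶*_ = Star _⟶β_

  infix 4 _⇛_
  data _⇛_ : Term C → Term C → Set where
    var  : ∀ {n} → var n ⇛ var n
    con  : ∀ {c} → con c ⇛ con c
    Π    : ∀ {A A′ B B′} → A ⇛ A′ → B ⇛ B′ → Π A B ⇛ Π A′ B′
    ƛ    : ∀ {A A′ M M′} → A ⇛ A′ → M ⇛ M′ → ƛ A M ⇛ ƛ A′ M′
    _·_  : ∀ {M M′ N N′} → M ⇛ M′ → N ⇛ N′ → M · N ⇛ M′ · N′
    β    : ∀ {A M M′ N N′} → M ⇛ M′ → N ⇛ N′ → ƛ A M · N ⇛ M′ [ N′ ]

  ⇛-refl : ∀ (M : Term C) → M ⇛ M
  ⇛-refl (var n) = var
  ⇛-refl (con c) = con
  ⇛-refl (Π A B) = Π (⇛-refl A) (⇛-refl B)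
  ⇛-refl (ƛ A M) = ƛ (⇛-refl A) (⇛-refl M)
  ⇛-refl (M · N) = ⇛-refl M · ⇛-refl N

  ⇛-rename : ∀ (ρ : ℕ → ℕ) {M M′ : Term C} → M ⇛ M′ → rename ρ M ⇛ rename ρ M′
  ⇛-rename ρ var     = var
  ⇛-rename ρ con     = con
  ⇛-rename ρ (Π p q) = Π (⇛-rename ρ p) (⇛-rename (ext {C} ρ) q)
  ⇛-rename ρ (ƛ p q) = ƛ (⇛-rename ρ p) (⇛-rename (ext {C} ρ) q)
  ⇛-rename ρ (p · q) = ⇛-rename ρ p · ⇛-rename ρ q
  ⇛-rename ρ (β {A} {M} {M′} {N} {N′} p q) =
    transport (rename ρ (ƛ A M · N) ⇛_) (sym (rename-[] ρ M′ N′))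
      (β (⇛-rename (ext {C} ρ) p) (⇛-rename ρ q))

  ⇛-exts : ∀ {σ τ : ℕ → Term C} → (∀ n → σ n ⇛ τ n) → ∀ n → exts σ n ⇛ exts τ n
  ⇛-exts h zero    = var
  ⇛-exts h (suc n) = ⇛-rename suc (h n)

  ⇛-subst : ∀ {σ τ : ℕ → Term C} → (∀ n → σ n ⇛ τ n) →
            ∀ {M M′} → M ⇛ M′ → subst σ M ⇛ subst τ M′
  ⇛-subst h (var {n}) = h n
  ⇛-subst h con       = con
  ⇛-subst h (Π p q)   = Π (⇛-subst h p) (⇛-subst (⇛-exts h) q)
  ⇛-subst h (ƛ p q)   = ƛ (⇛-subst h p) (⇛-subst (⇛-exts h) q)
  ⇛-subst h (p · q)   = ⇛-subst h p · ⇛-subst h q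
  ⇛-subst {σ} {τ} h (β {A} {M} {M′} {N} {N′} p q) =
    transport (subst σ (ƛ A M · N) ⇛_) (sym (subst-[] τ M′ N′))
      (β (⇛-subst (⇛-exts h) p) (⇛-subst h q))

  ⇛-[] : ∀ {M M′ N N′ : Term C} → M ⇛ M′ → N ⇛ N′ → M [ N ] ⇛ M′ [ N′ ]
  ⇛-[] {M} {M′} {N} {N′} p q =
    transport₂ _⇛_ (sym ([]-as-subst M N)) (sym ([]-as-subst M′ N′)) (⇛-subst sub₀-⇛ p)
    where
    sub₀-⇛ : ∀ n → sub₀ N n ⇛ sub₀ N′ n
    sub₀-⇛ zero    = q
    sub₀-⇛ (suc n) = var

  -- Takahashi's complete development.
  develop : Term C → Term C
  develop (var n)     = var n
  develop (con c)     = con c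
  develop (Π A B)     = Π (develop A) (develop B)
  develop (ƛ A M)     = ƛ (develop A) (develop M)
  develop (ƛ A M · N) = develop M [ develop N ]
  develop (M · N)     = develop M · develop N

  ⇛-develop : ∀ {M M′ : Term C} → M ⇛ M′ → M′ ⇛ develop M
  ⇛-develop var                 = var
  ⇛-develop con                 = con
  ⇛-develop (Π p q)             = Π (⇛-develop p) (⇛-develop q)
  ⇛-develop (ƛ p q)             = ƛ (⇛-develop p) (⇛-develop q)
  ⇛-develop (ƛ _ p · q)         = β (⇛-develop p) (⇛-develop q)
  ⇛-develop (p@var · q)         = ⇛-develop p · ⇛-develop q
  ⇛-develop (p@con · q)         = ⇛-develop p · ⇛-develop q
  ⇛-develop (p@(Π _ _) · q)     = ⇛-develop p · ⇛-develop q
  ⇛-develop (p@(_ · _) · q)     = ⇛-develop p · ⇛-develop q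
  ⇛-develop (p@(β _ _) · q)     = ⇛-develop p · ⇛-develop q
  ⇛-develop (β p q)             = ⇛-[] (⇛-develop p) (⇛-develop q)

  strip : ∀ {M N P : Term C} → M ⇛ N → Star _⇛_ M P → ∃[ Q ] Star _⇛_ N Q × P ⇛ Q
  strip p ε        = _ , ε , p
  strip p (q ◅ qs) with strip (⇛-develop q) qs
  ... | Q , r , s = Q , ⇛-develop p ◅ r , s

  ⇛-confluent : Confluent _⇛_
  ⇛-confluent ε        qs = _ , qs , ε
  ⇛-confluent (p ◅ ps) qs with strip p qs
  ... | Q , r , s with ⇛-confluent ps r
  ...   | Q′ , r′ , s′ = Q′ , r′ , s ◅ s′

  ⟶β-⇛ : ∀ {M N : Term C} → M ⟶β N → M ⇛ N
  ⟶β-⇛ β      = β (⇛-refl _) (⇛-refl _)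
  ⟶β-⇛ (Πˡ s) = Π (⟶β-⇛ s) (⇛-refl _)
  ⟶β-⇛ (Πʳ s) = Π (⇛-refl _) (⟶β-⇛ s)
  ⟶β-⇛ (ƛˡ s) = ƛ (⟶β-⇛ s) (⇛-refl _)
  ⟶β-⇛ (ƛʳ s) = ƛ (⇛-refl _) (⟶β-⇛ s)
  ⟶β-⇛ (·ˡ s) = ⟶β-⇛ s · ⇛-refl _
  ⟶β-⇛ (·ʳ s) = ⇛-refl _ · ⟶β-⇛ s

  ⇛-⟶* : ∀ {M N : Term C} → M ⇛ N → M ⟶* N
  ⇛-⟶* var     = ε
  ⇛-⟶* con     = ε
  ⇛-⟶* (Π {A′ = A′} {B} p q) = Star.gmap (λ X → Π X B) Πˡ (⇛-⟶* p) ◅◅ Star.gmap (Π A′) Πʳ (⇛-⟶* q)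
  ⇛-⟶* (ƛ {A′ = A′} {M} p q) = Star.gmap (λ X → ƛ X M) ƛˡ (⇛-⟶* p) ◅◅ Star.gmap (ƛ A′) ƛʳ (⇛-⟶* q)
  ⇛-⟶* (_·_ {M′ = M′} {N} p q) = Star.gmap (_· N) ·ˡ (⇛-⟶* p) ◅◅ Star.gmap (M′ ·_) ·ʳ (⇛-⟶* q)
  ⇛-⟶* (β {A} {M′ = M′} {N} p q) =
    Star.gmap (λ X → ƛ A X · N) (·ˡ ∘ ƛʳ) (⇛-⟶* p) ◅◅ Star.gmap (ƛ A M′ ·_) ·ʳ (⇛-⟶* q) ◅◅ β ◅ ε

  confluent : Confluent (_⟶β_ {C})
  confluent r s with ⇛-confluent (Star.map ⟶β-⇛ r) (Star.map ⟶β-⇛ s)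
  ... | Q , a , b = Q , Star.kleisliStar id ⇛-⟶* a , Star.kleisliStar id ⇛-⟶* b

module _ {C : Set} where

  con-normal : ∀ {c : C} → IsNormalForm _⟶β_ (con c)
  con-normal (_ , ())

  =β-con⇒⟶* : ∀ {M : Term C} {c} → M =β con c → M ⟶* con c
  =β-con⇒⟶* = conf⇒nf confluent con-normal

  con-injective-=β : ∀ {a b : C} → con a =β con b → a ≡ b
  con-injective-=β r with =β-con⇒⟶* r
  ... | ε = refl

  Π⟶*-con : ∀ {A B : Term C} {c} → ¬ (Π A B ⟶* con c)
  Π⟶*-con (Πˡ _ ◅ r) = Π⟶*-con r
  Π⟶*-con (Πʳ _ ◅ r) = Π⟶*-con r

  Π≠β-con : ∀ {A B : Term C} {c} → ¬ (Π A B =β con c)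
  Π≠β-con = Π⟶*-con ∘ =β-con⇒⟶*

  PiTerm : Term C → Set
  PiTerm (var n) = ⊤
  PiTerm (con c) = ⊤
  PiTerm (Π A B) = PiTerm A × PiTerm B
  PiTerm (ƛ A M) = ⊥
  PiTerm (M · N) = ⊥

  PiTerm-normal : ∀ {X : Term C} → PiTerm X → IsNormalForm _⟶β_ X
  PiTerm-normal {Π A B} (a , _) (_ , Πˡ s) = PiTerm-normal a (_ , s)
  PiTerm-normal {Π A B} (_ , b) (_ , Πʳ s) = PiTerm-normal b (_ , s)

  Πⁿ : Term C → ℕ → Term C → Term C
  Πⁿ A zero    B = B
  Πⁿ A (suc n) B = Π A (Πⁿ A n B)

  PiTerm-Πⁿ : ∀ {A B : Term C} n → PiTerm A → PiTerm B → PiTerm (Πⁿ A n B)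
  PiTerm-Πⁿ zero    a b = b
  PiTerm-Πⁿ (suc n) a b = a , PiTerm-Πⁿ n a b

  arity : Term C → ℕ
  arity (Π A B) = suc (arity B)
  arity _       = 0

  arity-Πⁿ : ∀ (A : Term C) n B → arity (Πⁿ A n B) ≡ n + arity B
  arity-Πⁿ A zero    B = refl
  arity-Πⁿ A (suc n) B = cong suc (arity-Πⁿ A n B)

  Πⁿ-injective : ∀ {A B : Term C} {i j} → Πⁿ A i B ≡ Πⁿ A j B → i ≡ j
  Πⁿ-injective {A} {B} {i} {j} e =
    +-cancelʳ-≡ (arity B) i j (trans (sym (arity-Πⁿ A i B)) (trans (cong arity e) (arity-Πⁿ A j B)))

  finitely-many-normal-forms : ∀ {L} (source : Fin L → Term C) (F : ℕ → Term C) →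
    (∀ n → IsNormalForm _⟶β_ (F n)) → (∀ {i j} → F i ≡ F j → i ≡ j) →
    ¬ (∀ n → ∃[ k ] source k ⟶* F n)
  finitely-many-normal-forms {L} source F normal injective reach =
    let i , j , i<j , same = pigeonhole (n<1+n L) (proj₁ ∘ reach ∘ toℕ)
        from-i = proj₂ (reach (toℕ i))
        from-j = transport (λ k → source k ⟶* F (toℕ j)) (sym same) (proj₂ (reach (toℕ j)))
    in <-irrefl (injective (conf⇒unf confluent (normal _) (normal _) (a—↠b&a—↠c⇒b↔c from-i from-j))) i<j

erase-PiTerm : ∀ {C} {X : Term C} → PiTerm X → PiTerm (erase X)
erase-PiTerm {X = var n} _       = tt
erase-PiTerm {X = con c} _       = tt
erase-PiTerm {X = Π A B} (a , b) = erase-PiTerm a , erase-PiTerm b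

erase-Πⁿ : ∀ {C} (A : Term C) n B → erase (Πⁿ A n B) ≡ Πⁿ (erase A) n (erase B)
erase-Πⁿ A zero    B = refl
erase-Πⁿ A (suc n) B = cong (Π (erase A)) (erase-Πⁿ A n B)

IsConstant : ∀ {C} → Term C → Set
IsConstant {C} X = ∃[ c ] X ≡ con {C} c

module CleanTerms {C : Set} (hidden binder : C → Bool) where

  BinderConstant : Term C → Set
  BinderConstant (con c) = T (binder c)
  BinderConstant _       = ⊥

  mutual
    Clean : Term C → Set
    Clean (var n) = ⊤
    Clean (con c) = ¬ T (hidden c)
    Clean (Π A B) = CleanDomain A × Clean B
    Clean (ƛ A M) = CleanDomain A × Clean M
    Clean (M · N) = Clean M × Clean N

    CleanDomain : Term C → Set
    CleanDomain A = Clean A ⊎ BinderConstant A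

  CleanOrConstant : Term C → Set
  CleanOrConstant X = Clean X ⊎ IsConstant X

  mutual
    Clean-rename : ∀ (ρ : ℕ → ℕ) (M : Term C) → Clean M → Clean (rename ρ M)
    Clean-rename ρ (var n) _       = tt
    Clean-rename ρ (con c) h       = h
    Clean-rename ρ (Π A B) (a , b) = CleanDomain-rename ρ A a , Clean-rename (ext {C} ρ) B b
    Clean-rename ρ (ƛ A M) (a , m) = CleanDomain-rename ρ A a , Clean-rename (ext {C} ρ) M m
    Clean-rename ρ (M · N) (m , n) = Clean-rename ρ M m , Clean-rename ρ N n

    CleanDomain-rename : ∀ (ρ : ℕ → ℕ) (A : Term C) → CleanDomain A → CleanDomain (rename ρ A)
    CleanDomain-rename ρ A       (inj₁ h) = inj₁ (Clean-rename ρ A h)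
    CleanDomain-rename ρ (con c) (inj₂ h) = inj₂ h

  CleanOrConstant-rename : ∀ (ρ : ℕ → ℕ) (M : Term C) → CleanOrConstant M → CleanOrConstant (rename ρ M)
  CleanOrConstant-rename ρ M (inj₁ h)            = inj₁ (Clean-rename ρ M h)
  CleanOrConstant-rename ρ M (inj₂ (c , refl))   = inj₂ (c , refl)

  Clean-exts : ∀ {σ : ℕ → Term C} → (∀ n → Clean (σ n)) → ∀ n → Clean (exts σ n)
  Clean-exts h zero    = tt
  Clean-exts h (suc n) = Clean-rename suc _ (h n)

  mutual
    Clean-subst : ∀ {σ : ℕ → Term C} → (∀ n → Clean (σ n)) → (M : Term C) → Clean M → Clean (subst σ M)
    Clean-subst h (var n) _       = h n
    Clean-subst h (con c) k       = k
    Clean-subst h (Π A B) (a , b) = CleanDomain-subst h A a , Clean-subst (Clean-exts h) B b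
    Clean-subst h (ƛ A M) (a , m) = CleanDomain-subst h A a , Clean-subst (Clean-exts h) M m
    Clean-subst h (M · N) (m , n) = Clean-subst h M m , Clean-subst h N n

    CleanDomain-subst : ∀ {σ : ℕ → Term C} → (∀ n → Clean (σ n)) →
                        (A : Term C) → CleanDomain A → CleanDomain (subst σ A)
    CleanDomain-subst h A       (inj₁ k) = inj₁ (Clean-subst h A k)
    CleanDomain-subst h (con c) (inj₂ k) = inj₂ k

  Clean-[] : ∀ (M N : Term C) → Clean M → Clean N → Clean (M [ N ])
  Clean-[] M N m n = transport Clean (sym ([]-as-subst M N)) (Clean-subst sub₀-clean M m)
    where
    sub₀-clean : ∀ k → Clean (sub₀ N k)
    sub₀-clean zero    = n
    sub₀-clean (suc k) = tt

  mutual
    Clean-⟶β : ∀ {M M′ : Term C} → Clean M → M ⟶β M′ → Clean M′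
    Clean-⟶β {ƛ A M · N} ((_ , m) , n) β = Clean-[] M N m n
    Clean-⟶β (a , b) (Πˡ s) = CleanDomain-⟶β a s , b
    Clean-⟶β (a , b) (Πʳ s) = a , Clean-⟶β b s
    Clean-⟶β (a , m) (ƛˡ s) = CleanDomain-⟶β a s , m
    Clean-⟶β (a , m) (ƛʳ s) = a , Clean-⟶β m s
    Clean-⟶β (m , n) (·ˡ s) = Clean-⟶β m s , n
    Clean-⟶β (m , n) (·ʳ s) = m , Clean-⟶β n s

    CleanDomain-⟶β : ∀ {A A′ : Term C} → CleanDomain A → A ⟶β A′ → CleanDomain A′
    CleanDomain-⟶β (inj₁ h) s = inj₁ (Clean-⟶β h s)
    CleanDomain-⟶β {con c} (inj₂ h) ()

  Clean-⟶* : ∀ {M M′ : Term C} → Clean M → M ⟶* M′ → Clean M′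
  Clean-⟶* h ε        = h
  Clean-⟶* h (s ◅ ss) = Clean-⟶* (Clean-⟶β h s) ss

  Clean-≠β-hidden : ∀ {M : Term C} {c} → Clean M → T (hidden c) → ¬ (M =β con c)
  Clean-≠β-hidden h c-hidden r = Clean-⟶* h (=β-con⇒⟶* r) c-hidden

  CleanDomain-≠β-hidden : ∀ {A : Term C} {s} → CleanDomain A → T (hidden s) → ¬ T (binder s) →
                          ¬ (A =β con s)
  CleanDomain-≠β-hidden (inj₁ a) s-hidden _ r = Clean-≠β-hidden a s-hidden r
  CleanDomain-≠β-hidden {con a} (inj₂ a-binder) _ not-binder r with con-injective-=β r
  ... | refl = not-binder a-binder

record Confinement (P : PTS) : Set where
  open PTS P
  field
    hidden binder : Const → Bool
    hidden-typed-by-hidden : ∀ {c s} → (c , s) ∈ axioms → T (hidden c) → T (hidden s) × ¬ T (binder s)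
    hidden-domain-binder   : ∀ {s₁ s₂ s₃ c} → (s₁ , s₂ , s₃) ∈ rules → (c , s₁) ∈ axioms →
                             T (hidden c) → T (binder c)
    hidden-not-range       : ∀ {s₁ s₂ s₃ c} → (s₁ , s₂ , s₃) ∈ rules → (c , s₂) ∈ axioms →
                             ¬ T (hidden c)

untyped-confinement : ∀ {P} (hidden : PTS.Const P → Bool) →
  (∀ {c s} → (c , s) ∈ PTS.axioms P → ¬ T (hidden c)) → Confinement P
untyped-confinement hidden untyped = record
  { hidden                 = hidden
  ; binder                 = λ _ → false
  ; hidden-typed-by-hidden = λ ax h → ⊥-elim (untyped ax h)
  ; hidden-domain-binder   = λ _ ax h → ⊥-elim (untyped ax h)
  ; hidden-not-range       = λ _ ax h → untyped ax h
  }

module Confined (P : PTS) (K : Confinement P) where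
  open PTS P
  open Typing P
  open Confinement K
  open CleanTerms hidden binder

  constant-generation : ∀ {Γ X Y c} → Γ ⊢ X ∶ Y → X ≡ con c → ∃[ s ] (c , s) ∈ axioms × Y =β con s
  constant-generation (axiom ax) refl = _ , ax , ε
  constant-generation (weakening {M = con _} _ d _) refl
    with constant-generation d refl
  ... | s , ax , r = s , ax , rename-=β suc r
  constant-generation (conversion _ d _ r) e
    with constant-generation d e
  ... | s , ax , r′ = s , ax , EqClosure.symmetric _⟶β_ r ◅◅ r′
  constant-generation (weakening {M = var _} _ _ _) ()
  constant-generation (weakening {M = Π _ _} _ _ _) ()
  constant-generation (weakening {M = ƛ _ _} _ _ _) ()
  constant-generation (weakening {M = _ · _} _ _ _) ()

  HiddenAxiom : Term Const → Term Const → Set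
  HiddenAxiom X Y = ∃[ c ] ∃[ s ] X ≡ con c × T (hidden c) × (c , s) ∈ axioms × Y =β con s

  clean-or-hidden : ∀ {Γ X Y} → Γ ⊢ X ∶ Y → CleanOrConstant X → Clean X ⊎ HiddenAxiom X Y
  clean-or-hidden d (inj₁ h) = inj₁ h
  clean-or-hidden d (inj₂ (c , refl)) with T? (hidden c)
  ... | no visible = inj₁ visible
  ... | yes h with constant-generation d refl
  ...   | s , ax , r = inj₂ (c , s , refl , h , ax , r)

  subject-clean : ∀ {Γ X Y} → Γ ⊢ X ∶ Y → CleanOrConstant X →
    (∀ {c s} → T (hidden c) → (c , s) ∈ axioms → ¬ (Y =β con s)) → Clean X
  subject-clean d x untypable =
    [ id , (λ { (_ , _ , refl , c-hidden , ax , r) → ⊥-elim (untypable c-hidden ax r) }) ]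
    (clean-or-hidden d x)

  Π-clean : ∀ {A B} → CleanOrConstant (Π A B) → Clean (Π A B)
  Π-clean (inj₁ h) = h

  application-clean : ∀ {Γ M N A B} → Γ ⊢ M ∶ Π A B → Γ ⊢ N ∶ A →
    CleanOrConstant M → CleanOrConstant (Π A B) → CleanOrConstant N →
    Clean M × Clean N × Clean (B [ N ])
  application-clean {N = N} {B = B} dM dN m ΠAB n =
    function , argument , Clean-[] B N (proj₂ (Π-clean ΠAB)) argument
    where
    function = subject-clean dM m λ _ _ → Π≠β-con
    argument = subject-clean dN n λ c-hidden ax →
      let s-hidden , not-binder = hidden-typed-by-hidden ax c-hidden
      in CleanDomain-≠β-hidden (proj₁ (Π-clean ΠAB)) s-hidden not-binder

  typing-clean : ∀ {Γ X Y} → Γ ⊢ X ∶ Y → CleanOrConstant X × CleanOrConstant Y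
  typing-clean (axiom _) = inj₂ (_ , refl) , inj₂ (_ , refl)
  typing-clean (start {A = A} _ d) = inj₁ tt , CleanOrConstant-rename suc A (proj₁ (typing-clean d))
  typing-clean (weakening {M = M} {B} _ d _) =
    let m , b = typing-clean d in CleanOrConstant-rename suc M m , CleanOrConstant-rename suc B b
  typing-clean (application dM dN) =
    let m , ΠAB = typing-clean dM
        function , argument , result = application-clean dM dN m ΠAB (proj₁ (typing-clean dN))
    in inj₁ (function , argument) , inj₁ result
  typing-clean (abstraction _ dM dΠ) =
    let a , b = Π-clean (proj₁ (typing-clean dΠ))
        body = subject-clean dM (proj₁ (typing-clean dM)) λ c-hidden ax →
                 Clean-≠β-hidden b (proj₁ (hidden-typed-by-hidden ax c-hidden))
    in inj₁ (a , body) , inj₁ (a , b)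
  typing-clean (product dB dA rule) =
    let domain = [ inj₁ , (λ { (_ , _ , refl , c-hidden , ax , r) →
                     inj₂ (hidden-domain-binder rule (axiom-of r ax) c-hidden) }) ]
                 (clean-or-hidden dA (proj₁ (typing-clean dA)))
        range = subject-clean dB (proj₁ (typing-clean dB)) λ c-hidden ax r →
                  hidden-not-range rule (axiom-of r ax) c-hidden
    in inj₁ (domain , range) , inj₂ (_ , refl)
    where
    axiom-of : ∀ {c s s′} → con s′ =β con s → (c , s) ∈ axioms → (c , s′) ∈ axioms
    axiom-of r ax = transport (λ s → (_ , s) ∈ axioms) (sym (con-injective-=β r)) ax
  typing-clean (conversion _ dM dB _) = proj₁ (typing-clean dM) , proj₁ (typing-clean dB)

  application-type-clean : ∀ {Γ M N A B} → Γ ⊢ M ∶ Π A B → Γ ⊢ N ∶ A → Clean (B [ N ])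
  application-type-clean dM dN =
    let m , ΠAB = typing-clean dM
    in proj₂ (proj₂ (application-clean dM dN m ΠAB (proj₁ (typing-clean dN))))

module Hilbert (P : PTS) (𝓑 : List (Typing.Scheme P)) where
  open PTS P
  open Typing P

  subject-shape : Fin (suc (length 𝓑)) → Term ⊤
  subject-shape fzero    = con tt
  subject-shape (fsuc i) = erase (proj₁ (lookup 𝓑 i))

  -- Erasure forgets how the sort variables of a scheme are instantiated, so only
  -- finitely many subjects remain.
  reduct-of-subject-shape : ∀ {u M A} →
    (∀ {M N A B} → ⊢H[ 𝓑 ] M ∶ Π A B → ⊢H[ 𝓑 ] N ∶ A → ¬ ((B [ N ]) =β con u)) →
    ⊢H[ 𝓑 ] M ∶ A → A =β con u → ∃[ i ] subject-shape i ⟶* erase M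
  reduct-of-subject-shape _ (axiom _) _ = fzero , ε
  reduct-of-subject-shape _ (scheme {M} p σ) _ =
    fsuc (index p) , reflexive _⟶β_ (trans (cong (erase ∘ proj₁) (sym (lookup-index p)))
                                           (sym (erase-mapCon _ M)))
  reduct-of-subject-shape no-app (application dM dN) r = ⊥-elim (no-app dM dN r)
  reduct-of-subject-shape no-app (conversion _ d _ r′) r = reduct-of-subject-shape no-app d (r′ ◅◅ r)
  reduct-of-subject-shape no-app (type-reduction d s) r = reduct-of-subject-shape no-app d (fwd s ◅ r)
  reduct-of-subject-shape no-app (subject-reduction d s) r =
    let i , steps = reduct-of-subject-shape no-app d r
    in i , steps ◅◅ mapCon-⟶β _ s ◅ ε

record Obstruction (P : PTS) : Set where
  open PTS P
  open Typing P
  field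
    confinement : Confinement P
    sort        : Const
    sort-hidden : T (Confinement.hidden confinement sort)
    family      : ℕ → Term Const
    family-typed    : ∀ n → [] ⊢ family n ∶ con sort
    family-PiTerm   : ∀ n → PiTerm (family n)
    erase-family-injective : ∀ {i j} → erase (family i) ≡ erase (family j) → i ≡ j

no-equivalent-HPTS : ∀ {P} → Obstruction P → ¬ Typing.HasEquivalentHPTS P
no-equivalent-HPTS {P} O (𝓑 , equivalent) =
  finitely-many-normal-forms subject-shape (erase ∘ family)
    (λ n → PiTerm-normal (erase-PiTerm (family-PiTerm n))) erase-family-injective
    (λ n → reduct-of-subject-shape no-hidden-application (complete (family-typed n)) ε)
  where
  open Typing P
  open Obstruction O
  open Confined P confinement
  open CleanTerms (Confinement.hidden confinement) (Confinement.binder confinement)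
  open Hilbert P 𝓑

  complete : ∀ {M A} → [] ⊢ M ∶ A → ⊢H[ 𝓑 ] M ∶ A
  complete = proj₁ (equivalent _ _)

  sound : ∀ {M A} → ⊢H[ 𝓑 ] M ∶ A → [] ⊢ M ∶ A
  sound = proj₂ (equivalent _ _)

  no-hidden-application : ∀ {M N A B} → ⊢H[ 𝓑 ] M ∶ Π A B → ⊢H[ 𝓑 ] N ∶ A → ¬ ((B [ N ]) =β con sort)
  no-hidden-application dM dN = Clean-≠β-hidden (application-type-clean (sound dM) (sound dN)) sort-hidden

Πⁿ-obstruction : ∀ {P} (K : Confinement P) (u : PTS.Const P) → T (Confinement.hidden K u) →
  (A B : Term (PTS.Const P)) → PiTerm A → PiTerm B →
  (∀ n → Typing._⊢_∶_ P [] (Πⁿ A n B) (con u)) → Obstruction P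
Πⁿ-obstruction K u u-hidden A B a b typed = record
  { confinement  = K
  ; sort         = u
  ; sort-hidden  = u-hidden
  ; family       = λ n → Πⁿ A n B
  ; family-typed = typed
  ; family-PiTerm = λ n → PiTerm-Πⁿ n a b
  ; erase-family-injective = λ {i} {j} e →
      Πⁿ-injective (trans (sym (erase-Πⁿ A i B)) (trans e (erase-Πⁿ A j B)))
  }

module Telescopes (P : PTS) where
  open PTS P
  open Typing P

  axiom-in-telescope : ∀ {A c s sA} → Sort sA → (c , s) ∈ axioms →
    (∀ {Γ} → Γ ⊢ con c ∶ con s → Γ ⊢ A ∶ con sA) → ∀ k → replicate k A ⊢ con c ∶ con s
  axiom-in-telescope _  ax _     zero    = axiom ax
  axiom-in-telescope sA ax typeA (suc k) =
    let c∶s = axiom-in-telescope sA ax typeA k in weakening sA c∶s (typeA c∶s)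

  Πⁿ-typed : ∀ {A B s₁ s₂} → (s₁ , s₂ , s₂) ∈ rules →
    (∀ k → replicate k A ⊢ A ∶ con s₁) → (∀ k → replicate k A ⊢ B ∶ con s₂) →
    ∀ n k → replicate k A ⊢ Πⁿ A n B ∶ con s₂
  Πⁿ-typed rule hA hB zero    k = hB k
  Πⁿ-typed rule hA hB (suc n) k = product (Πⁿ-typed rule hA hB n (suc k)) (hA k) rule

  Πⁿ-axiom-typed : ∀ {c s} → (c , s) ∈ axioms → Sort s → (s , s , s) ∈ rules →
    ∀ n → [] ⊢ Πⁿ (con c) n (con c) ∶ con s
  Πⁿ-axiom-typed ax s rule n = Πⁿ-typed rule c∶s c∶s n 0
    where c∶s = axiom-in-telescope s ax id

open Telescopes

λτ-obstruction : Obstruction λτ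
λτ-obstruction = Πⁿ-obstruction (untyped-confinement hidden λ { (here refl) () ; (there ()) })
  ⋆ tt (con 𝟎) (con 𝟎) tt tt (Πⁿ-axiom-typed λτ (here refl) (here refl) (here refl))
  where
  hidden : Kτ → Bool
  hidden ⋆ = true
  hidden 𝟎 = false

confinement-□ : ∀ R → Confinement (mk₂ R)
confinement-□ R = untyped-confinement hidden λ { (here refl) () ; (there ()) }
  where
  hidden : K₂ → Bool
  hidden ⋆ = false
  hidden □ = true

□□-obstruction : ∀ {R} → (□ , □ , □) ∈ R → Obstruction (mk₂ R)
□□-obstruction {R} rule = Πⁿ-obstruction (confinement-□ R) □ tt (con ⋆) (con ⋆) tt tt
  (Πⁿ-axiom-typed (mk₂ R) (here refl) (there (here refl)) rule)

falsum : Term K₂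
falsum = Π (con ⋆) (var 0)

falsum-typed : ∀ {R Γ} → (□ , ⋆ , ⋆) ∈ R →
  Typing._⊢_∶_ (mk₂ R) Γ (con ⋆) (con □) → Typing._⊢_∶_ (mk₂ R) Γ falsum (con ⋆)
falsum-typed {R} rule ⋆∶□ = product (start (there (here refl)) ⋆∶□) ⋆∶□ rule
  where open Typing (mk₂ R)

λP2-obstruction : Obstruction λP2
λP2-obstruction = Πⁿ-obstruction (confinement-□ _) □ tt falsum (con ⋆) (tt , tt) tt
  (λ n → Πⁿ-typed λP2 (there (there (here refl))) (falsum-typed (there (here refl)) ∘ ⋆∶□) ⋆∶□ n 0)
  where
  ⋆∶□ : ∀ k → Typing._⊢_∶_ λP2 (replicate k falsum) (con ⋆) (con □)
  ⋆∶□ = axiom-in-telescope λP2 (here refl) (here refl) (falsum-typed (there (here refl)))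

-- In λ2 the sort ⋆ is itself typable, so it has to be hidden as well; it may
-- then still occur as the domain of a polymorphic quantification Π α:⋆.
confinement-λ2 : Confinement λ2
confinement-λ2 = record
  { hidden                 = λ _ → true
  ; binder                 = binder
  ; hidden-typed-by-hidden = λ { (here refl) _ → tt , λ () ; (there ()) }
  ; hidden-domain-binder   = λ { _ (here refl) _ → tt ; _ (there ()) }
  ; hidden-not-range       = not-range
  }
  where
  binder : K₂ → Bool
  binder ⋆ = true
  binder □ = false
  not-range : ∀ {s₁ s₂ s₃ c} → (s₁ , s₂ , s₃) ∈ PTS.rules λ2 → (c , s₂) ∈ PTS.axioms λ2 → ¬ T true
  not-range (here ())                 (here refl)
  not-range (there (here ()))         (here refl)
  not-range (there (there ()))        (here refl)
  not-range _                         (there ())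

λ2-obstruction : Obstruction λ2
λ2-obstruction = Πⁿ-obstruction confinement-λ2 ⋆ tt (con ⋆) falsum tt (tt , tt)
  (λ n → Πⁿ-typed λ2 (there (here refl)) ⋆∶□ (falsum-typed (there (here refl)) ∘ ⋆∶□) n 0)
  where
  ⋆∶□ : ∀ k → Typing._⊢_∶_ λ2 (replicate k (con ⋆)) (con ⋆) (con □)
  ⋆∶□ = axiom-in-telescope λ2 (there (here refl)) (here refl) id

AUT-obstruction : ∀ {R} → (□ , □ , △) ∈ R → (□ , △ , △) ∈ R → Obstruction (mk₃ ((⋆ , □) ∷ []) R)
AUT-obstruction {R} □□△ □△△ = Πⁿ-obstruction confinement △ tt (con ⋆) (Π (con ⋆) (con ⋆)) tt (tt , tt)
  (λ n → Πⁿ-typed P □△△ ⋆∶□ (λ k → product (⋆∶□ (suc k)) (⋆∶□ k) □□△) n 0)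
  where
  P = mk₃ ((⋆ , □) ∷ []) R
  open Typing P
  hidden : K₃ → Bool
  hidden △ = true
  hidden _ = false
  confinement : Confinement P
  confinement = untyped-confinement hidden λ { (here refl) () ; (there ()) }
  ⋆∶□ : ∀ k → Typing._⊢_∶_ P (replicate k (con ⋆)) (con ⋆) (con □)
  ⋆∶□ = axiom-in-telescope P (there (here refl)) (here refl) id

universe-obstruction : ∀ {R} → (□ , □ , □) ∈ R → (∀ {s₁ s₃} → ¬ ((s₁ , △ , s₃) ∈ R)) →
  Obstruction (mk₃ ((⋆ , □) ∷ (□ , △) ∷ []) R)
universe-obstruction {R} □□□ no-△-range = Πⁿ-obstruction confinement □ tt (con ⋆) (con ⋆) tt tt
  (Πⁿ-axiom-typed P (here refl) (there (here refl)) □□□)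
  where
  P = mk₃ ((⋆ , □) ∷ (□ , △) ∷ []) R
  hidden binder : K₃ → Bool
  hidden ⋆ = false
  hidden _ = true
  binder □ = true
  binder _ = false
  confinement : Confinement P
  confinement = record
    { hidden                 = hidden
    ; binder                 = binder
    ; hidden-typed-by-hidden = λ { (here refl) () ; (there (here refl)) _ → tt , λ () ; (there (there ())) }
    ; hidden-domain-binder   = λ { _ (here refl) () ; _ (there (here refl)) _ → tt ; _ (there (there ())) }
    ; hidden-not-range       = λ { _ (here refl) () ; rule (there (here refl)) _ → no-△-range rule
                                 ; _ (there (there ())) }
    }

λU-no-△-range : ∀ {s₁ s₃} → ¬ ((s₁ , △ , s₃) ∈ PTS.rules λU)
λU-no-△-range (here ())
λU-no-△-range (there (here ()))
λU-no-△-range (there (there (here ())))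
λU-no-△-range (there (there (there (here ()))))
λU-no-△-range (there (there (there (there (here ())))))
λU-no-△-range (there (there (there (there (there ())))))

λHOL-no-△-range : ∀ {s₁ s₃} → ¬ ((s₁ , △ , s₃) ∈ PTS.rules λHOL)
λHOL-no-△-range (here ())
λHOL-no-△-range (there (here ()))
λHOL-no-△-range (there (there (here ())))
λHOL-no-△-range (there (there (there ())))

obstruction : (S : System) → Obstruction (pts S)
obstruction sλτ      = λτ-obstruction
obstruction sλ2      = λ2-obstruction
obstruction sλω      = □□-obstruction (there (there (here refl)))
obstruction sλω̲      = □□-obstruction (there (here refl))
obstruction sλP2     = λP2-obstruction
obstruction sλPω̲     = □□-obstruction (there (there (here refl)))
obstruction sλC      = □□-obstruction (there (there (there (here refl))))
obstruction sλAUT-68 = AUT-obstruction (there (there (there (here refl))))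
                                       (there (there (there (there (there (here refl))))))
obstruction sλAUT-QE = AUT-obstruction (there (there (there (here refl))))
                                       (there (there (there (there (there (here refl))))))
obstruction sλPAL    = AUT-obstruction (there (there (there (here refl))))
                                       (there (there (there (there (there (here refl))))))
obstruction sλU      = universe-obstruction (there (there (here refl))) λU-no-△-range
obstruction sλHOL    = universe-obstruction (there (there (here refl))) λHOL-no-△-range

theorem15 : (S : System) → ¬ Typing.HasEquivalentHPTS (pts S)
theorem15 S = no-equivalent-HPTS (obstruction S)
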